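{- $E_{\mathsf{ftc-cm}}\cup\{\mathsf{AVL}\}\vdash x\cdot x=0\to x=0$.
   Context: $\Sigma$ is the signature with constants $0,1,\bot$, unary $-$, binary $+,\cdot,\div$; $x\div y$ is written $\frac{x}{y}$. $E_{\mathsf{ftc-cm}}$ is the following set of equations: $(x+y)+z=x+(y+z)$; $x+y=y+x$; $x+0=x$; $x+(-x)=0\cdot x$; $x\cdot(y\cdot z)=(x\cdot y)\cdot z$; $x\cdot y=y\cdot x$; $1\cdot x=x$; $x\cdot(y+z)=(x\cdot y)+(x\cdot z)$; $-(-x)=x$; $0\cdot(x\cdot x)=0\cdot x$; $x+\bot=\bot$; $x=\frac{x}{1}$; $\frac{x}{y}\cdot\frac{u}{v}=\frac{x\cdot u}{y\cdot v}$; $\frac{x}{y}+\frac{u}{v}=\frac{(x\cdot v)+(y\cdot u)}{y\cdot v}$; $\frac{x}{y+(0\cdot z)}=\frac{x+(0\cdot z)}{y}$; $\bot=\frac{1}{0}$. $\mathsf{AVL}$ is the conditional equation $\frac{1}{x}=\bot\to 0\cdot x=x$. $\vdash$ is derivability in conditional equational logic (equivalently first order logic). -}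

module Defs where

open import Data.Nat using (ℕ)

infixl 6 _⊕_
infixl 7 _⊙_
infixl 7 _⊘_

data Term : Set where
  var : ℕ → Term
  `0 `1 `⊥ : Term
  ⊖_ : Term → Term
  _⊕_ _⊙_ _⊘_ : Term → Term → Term

Subst : Set
Subst = ℕ → Term

_[_] : Term → Subst → Term
var n [ σ ] = σ n
`0 [ σ ] = `0
`1 [ σ ] = `1
`⊥ [ σ ] = `⊥
(⊖ t) [ σ ] = ⊖ (t [ σ ])
(s ⊕ t) [ σ ] = (s [ σ ]) ⊕ (t [ σ ])
(s ⊙ t) [ σ ] = (s [ σ ]) ⊙ (t [ σ ])
(s ⊘ t) [ σ ] = (s [ σ ]) ⊘ (t [ σ ])

x y z u v : Term
x = var 0
y = var 1
z = var 2
u = var 3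
v = var 4

data E-ftc-cm : Term → Term → Set where
  e1  : E-ftc-cm ((x ⊕ y) ⊕ z) (x ⊕ (y ⊕ z))
  e2  : E-ftc-cm (x ⊕ y) (y ⊕ x)
  e3  : E-ftc-cm (x ⊕ `0) x
  e4  : E-ftc-cm (x ⊕ (⊖ x)) (`0 ⊙ x)
  e5  : E-ftc-cm (x ⊙ (y ⊙ z)) ((x ⊙ y) ⊙ z)
  e6  : E-ftc-cm (x ⊙ y) (y ⊙ x)
  e7  : E-ftc-cm (`1 ⊙ x) x
  e8  : E-ftc-cm (x ⊙ (y ⊕ z)) ((x ⊙ y) ⊕ (x ⊙ z))
  e9  : E-ftc-cm (⊖ (⊖ x)) x
  e10 : E-ftc-cm (`0 ⊙ (x ⊙ x)) (`0 ⊙ x)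
  e11 : E-ftc-cm (x ⊕ `⊥) `⊥
  e12 : E-ftc-cm x (x ⊘ `1)
  e13 : E-ftc-cm ((x ⊘ y) ⊙ (u ⊘ v)) ((x ⊙ u) ⊘ (y ⊙ v))
  e14 : E-ftc-cm ((x ⊘ y) ⊕ (u ⊘ v)) (((x ⊙ v) ⊕ (y ⊙ u)) ⊘ (y ⊙ v))
  e15 : E-ftc-cm (x ⊘ (y ⊕ (`0 ⊙ z))) ((x ⊕ (`0 ⊙ z)) ⊘ y)
  e16 : E-ftc-cm `⊥ (`1 ⊘ `0)

-- Conditional equations  s = t → l = r , as a predicate on (s , t , l , r).
-- AVL :  1/x = ⊥ → 0·x = x
data AVL : Term → Term → Term → Term → Set where
  avl : AVL (`1 ⊘ x) `⊥ (`0 ⊙ x) x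

-- Ax  : unconditional axioms (closed under substitution),
-- CAx : conditional axioms (closed under substitution),
-- H   : hypotheses (the premises of the conditional equation to be derived;
--       their variables behave as constants, i.e. are NOT substituted).
data Deriv (Ax : Term → Term → Set) (CAx : Term → Term → Term → Term → Set)
           (H : Term → Term → Set) : Term → Term → Set where
  hyp   : ∀ {s t} → H s t → Deriv Ax CAx H s t
  ax    : ∀ {l r} → Ax l r → (σ : Subst) → Deriv Ax CAx H (l [ σ ]) (r [ σ ])
  cax   : ∀ {s t l r} → CAx s t l r → (σ : Subst) →
          Deriv Ax CAx H (s [ σ ]) (t [ σ ]) → Deriv Ax CAx H (l [ σ ]) (r [ σ ])
  refl  : ∀ {t} → Deriv Ax CAx H t t
  sym   : ∀ {s t} → Deriv Ax CAx H s t → Deriv Ax CAx H t s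
  trans : ∀ {s t w} → Deriv Ax CAx H s t → Deriv Ax CAx H t w → Deriv Ax CAx H s w
  cong⊖ : ∀ {s t} → Deriv Ax CAx H s t → Deriv Ax CAx H (⊖ s) (⊖ t)
  cong⊕ : ∀ {s s' t t'} → Deriv Ax CAx H s s' → Deriv Ax CAx H t t' →
          Deriv Ax CAx H (s ⊕ t) (s' ⊕ t')
  cong⊙ : ∀ {s s' t t'} → Deriv Ax CAx H s s' → Deriv Ax CAx H t t' →
          Deriv Ax CAx H (s ⊙ t) (s' ⊙ t')
  cong⊘ : ∀ {s s' t t'} → Deriv Ax CAx H s s' → Deriv Ax CAx H t t' →
          Deriv Ax CAx H (s ⊘ t) (s' ⊘ t')

data Single (s t : Term) : Term → Term → Set where
  here : Single s t s t

⊢ftc-cm+AVL : Term → Term → Term → Term → Set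
⊢ftc-cm+AVL s t l r = Deriv E-ftc-cm AVL (Single s t) l r

-- If x·x = 0 then 0·(1/x) = 0·(1/x · 1/x) = 0·(1/(x·x)) = 0·⊥ = ⊥, and since
-- every term absorbs its own zero multiple, 1/x = 1/x + 0·(1/x) = 1/x + ⊥ = ⊥.
-- AVL now yields x = 0·x = 0·(x·x) = 0·0 = 0.
module Submission where

open import Data.List using (List; []; _∷_)
open import Data.Nat using (zero; suc)
open import Relation.Binary.Bundles using (Setoid)
import Relation.Binary.Reasoning.Setoid as SetoidReasoning
open import Defs

-- Instantiates x, y, z, u, v in turn; unlisted variables are set to 0.
⟨_⟩ : List Term → Subst
⟨ [] ⟩ _ = `0
⟨ t ∷ ts ⟩ zero = t
⟨ t ∷ ts ⟩ (suc n) = ⟨ ts ⟩ n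

module FtcCm {CAx : Term → Term → Term → Term → Set} {H : Term → Term → Set} where

  infix 4 _≈_
  _≈_ : Term → Term → Set
  _≈_ = Deriv E-ftc-cm CAx H

  ≈-setoid : Setoid _ _
  ≈-setoid = record
    { Carrier = Term
    ; _≈_ = _≈_
    ; isEquivalence = record { refl = refl ; sym = sym ; trans = trans }
    }

  open SetoidReasoning ≈-setoid

  +-comm : ∀ a b → a ⊕ b ≈ b ⊕ a
  +-comm a b = ax e2 ⟨ a ∷ b ∷ [] ⟩

  +-identityʳ : ∀ a → a ⊕ `0 ≈ a
  +-identityʳ a = ax e3 ⟨ a ∷ [] ⟩

  ·-comm : ∀ a b → a ⊙ b ≈ b ⊙ a
  ·-comm a b = ax e6 ⟨ a ∷ b ∷ [] ⟩

  ·-identityˡ : ∀ a → `1 ⊙ a ≈ a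
  ·-identityˡ a = ax e7 ⟨ a ∷ [] ⟩

  ·-identityʳ : ∀ a → a ⊙ `1 ≈ a
  ·-identityʳ a = trans (·-comm a `1) (·-identityˡ a)

  ·-distribˡ-+ : ∀ a b c → a ⊙ (b ⊕ c) ≈ a ⊙ b ⊕ a ⊙ c
  ·-distribˡ-+ a b c = ax e8 ⟨ a ∷ b ∷ c ∷ [] ⟩

  0·-square : ∀ a → `0 ⊙ (a ⊙ a) ≈ `0 ⊙ a
  0·-square a = ax e10 ⟨ a ∷ [] ⟩

  +-zeroʳ-⊥ : ∀ a → a ⊕ `⊥ ≈ `⊥
  +-zeroʳ-⊥ a = ax e11 ⟨ a ∷ [] ⟩

  ÷-identityʳ : ∀ a → a ≈ a ⊘ `1
  ÷-identityʳ a = ax e12 ⟨ a ∷ [] ⟩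

  ÷-·-÷ : ∀ a b c d → (a ⊘ b) ⊙ (c ⊘ d) ≈ (a ⊙ c) ⊘ (b ⊙ d)
  ÷-·-÷ a b c d = ax e13 ⟨ a ∷ b ∷ `0 ∷ c ∷ d ∷ [] ⟩

  ÷-+-÷ : ∀ a b c d → (a ⊘ b) ⊕ (c ⊘ d) ≈ (a ⊙ d ⊕ b ⊙ c) ⊘ (b ⊙ d)
  ÷-+-÷ a b c d = ax e14 ⟨ a ∷ b ∷ `0 ∷ c ∷ d ∷ [] ⟩

  ⊥≈1÷0 : `⊥ ≈ `1 ⊘ `0
  ⊥≈1÷0 = ax e16 ⟨ [] ⟩

  +-0·-absorb : ∀ a → a ⊕ `0 ⊙ a ≈ a
  +-0·-absorb a = begin
    a ⊕ `0 ⊙ a          ≈⟨ cong⊕ (sym (·-identityʳ a)) (·-comm `0 a) ⟩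
    a ⊙ `1 ⊕ a ⊙ `0     ≈⟨ sym (·-distribˡ-+ a `1 `0) ⟩
    a ⊙ (`1 ⊕ `0)       ≈⟨ cong⊙ refl (+-identityʳ `1) ⟩
    a ⊙ `1              ≈⟨ ·-identityʳ a ⟩
    a                   ∎

  0·0≈0 : `0 ⊙ `0 ≈ `0
  0·0≈0 = begin
    `0 ⊙ `0             ≈⟨ sym (+-identityʳ (`0 ⊙ `0)) ⟩
    `0 ⊙ `0 ⊕ `0        ≈⟨ +-comm (`0 ⊙ `0) `0 ⟩
    `0 ⊕ `0 ⊙ `0        ≈⟨ +-0·-absorb `0 ⟩
    `0                  ∎

  0÷0≈⊥ : `0 ⊘ `0 ≈ `⊥
  0÷0≈⊥ = begin
    `0 ⊘ `0                            ≈⟨ cong⊘ (sym (+-identityʳ `0)) refl ⟩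
    (`0 ⊕ `0) ⊘ `0                     ≈⟨ sym (cong⊘ (cong⊕ (·-identityˡ `0) 0·0≈0) 0·0≈0) ⟩
    (`1 ⊙ `0 ⊕ `0 ⊙ `0) ⊘ (`0 ⊙ `0)    ≈⟨ sym (÷-+-÷ `1 `0 `0 `0) ⟩
    `1 ⊘ `0 ⊕ `0 ⊘ `0                  ≈⟨ cong⊕ (sym ⊥≈1÷0) refl ⟩
    `⊥ ⊕ `0 ⊘ `0                       ≈⟨ +-comm `⊥ (`0 ⊘ `0) ⟩
    `0 ⊘ `0 ⊕ `⊥                       ≈⟨ +-zeroʳ-⊥ (`0 ⊘ `0) ⟩
    `⊥                                 ∎

  0·⊥≈⊥ : `0 ⊙ `⊥ ≈ `⊥
  0·⊥≈⊥ = begin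
    `0 ⊙ `⊥                     ≈⟨ cong⊙ (÷-identityʳ `0) ⊥≈1÷0 ⟩
    (`0 ⊘ `1) ⊙ (`1 ⊘ `0)       ≈⟨ ÷-·-÷ `0 `1 `1 `0 ⟩
    (`0 ⊙ `1) ⊘ (`1 ⊙ `0)       ≈⟨ cong⊘ (·-identityʳ `0) (·-identityˡ `0) ⟩
    `0 ⊘ `0                     ≈⟨ 0÷0≈⊥ ⟩
    `⊥                          ∎

  0·≈⊥⇒≈⊥ : ∀ {a} → `0 ⊙ a ≈ `⊥ → a ≈ `⊥
  0·≈⊥⇒≈⊥ {a} 0·a≈⊥ = begin
    a                   ≈⟨ sym (+-0·-absorb a) ⟩
    a ⊕ `0 ⊙ a          ≈⟨ cong⊕ refl 0·a≈⊥ ⟩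
    a ⊕ `⊥              ≈⟨ +-zeroʳ-⊥ a ⟩
    `⊥                  ∎

  nilpotent⇒1÷≈⊥ : ∀ {a} → a ⊙ a ≈ `0 → `1 ⊘ a ≈ `⊥
  nilpotent⇒1÷≈⊥ {a} a²≈0 = 0·≈⊥⇒≈⊥ (begin
    `0 ⊙ (`1 ⊘ a)                   ≈⟨ sym (0·-square (`1 ⊘ a)) ⟩
    `0 ⊙ ((`1 ⊘ a) ⊙ (`1 ⊘ a))      ≈⟨ cong⊙ refl (÷-·-÷ `1 a `1 a) ⟩
    `0 ⊙ ((`1 ⊙ `1) ⊘ (a ⊙ a))      ≈⟨ cong⊙ refl (cong⊘ (·-identityˡ `1) a²≈0) ⟩
    `0 ⊙ (`1 ⊘ `0)                  ≈⟨ cong⊙ refl (sym ⊥≈1÷0) ⟩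
    `0 ⊙ `⊥                         ≈⟨ 0·⊥≈⊥ ⟩
    `⊥                              ∎)

module FtcCmAVL {H : Term → Term → Set} where

  open FtcCm {AVL} {H}
  open SetoidReasoning ≈-setoid

  nilpotent⇒≈0 : ∀ {a} → a ⊙ a ≈ `0 → a ≈ `0
  nilpotent⇒≈0 {a} a²≈0 = begin
    a                   ≈⟨ sym (cax avl ⟨ a ∷ [] ⟩ (nilpotent⇒1÷≈⊥ a²≈0)) ⟩
    `0 ⊙ a              ≈⟨ sym (0·-square a) ⟩
    `0 ⊙ (a ⊙ a)        ≈⟨ cong⊙ refl a²≈0 ⟩
    `0 ⊙ `0             ≈⟨ 0·0≈0 ⟩
    `0                  ∎

mainTheorem5 : ⊢ftc-cm+AVL (x ⊙ x) `0 x `0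
mainTheorem5 = FtcCmAVL.nilpotent⇒≈0 (hyp here)
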